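{- For integers $r, i \ge 2$ and $k \ge i(r-1)+1$, $\beta_i(k,r) \le i(r-1)+1$.
   Context: A $k$-partite graph comes with a fixed partition of its vertex set into $k$ parts (parts may be empty). For $k \ge r \ge 2$ and $1 \le i \le k-r+1$, $\beta_i(k,r)$ is the minimum number of vertices of a $K_r$-free $k$-partite graph such that, for every choice of $k-i$ of its parts, the subgraph induced by those parts contains a $K_{r-1}$. -}

module Defs where

open import Data.Nat using (ℕ; _+_; _*_; _∸_; _≤_)
open import Data.Fin using (Fin)
open import Data.Fin.Subset using (Subset; _∈_; ∣_∣)
open import Data.Product using (Σ; ∃; _×_)
open import Relation.Binary.PropositionalEquality using (_≡_; _≢_)
open import Relation.Nullary using (¬_)

-- A simple graph on vertex set Fin n together with a fixed partition of its
-- vertices into k (possibly empty) parts, such that every part is an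
-- independent set (i.e. a k-partite graph).
record KPartiteGraph (k n : ℕ) : Set₁ where
  field
    Adj      : Fin n → Fin n → Set
    sym      : ∀ {u v} → Adj u v → Adj v u
    irrefl   : ∀ {u} → ¬ Adj u u
    part     : Fin n → Fin k
    partite  : ∀ {u v} → Adj u v → part u ≢ part v

open KPartiteGraph public

-- A copy of K_m in G: m vertices that are pairwise adjacent
-- (distinctness of the vertices follows from irreflexivity).
IsClique : ∀ {k n m} → KPartiteGraph k n → (Fin m → Fin n) → Set
IsClique {m = m} G f = ∀ (a b : Fin m) → a ≢ b → Adj G (f a) (f b)

KFree : ∀ {k n} → KPartiteGraph k n → ℕ → Set
KFree {n = n} G r = ¬ (Σ (Fin r → Fin n) λ f → IsClique G f)

ContainsCliqueIn : ∀ {k n} → KPartiteGraph k n → Subset k → ℕ → Set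
ContainsCliqueIn {n = n} G S m =
  Σ (Fin m → Fin n) λ f → IsClique G f × (∀ a → part G (f a) ∈ S)

IsBetaWitness : ∀ {k n} → ℕ → ℕ → KPartiteGraph k n → Set
IsBetaWitness {k} i r G =
  KFree G r × (∀ (S : Subset k) → ∣ S ∣ ≡ k ∸ i → ContainsCliqueIn G S (r ∸ 1))

-- "β_i(k,r) ≤ N": since β_i(k,r) is the minimum number of vertices of such a
-- graph, β_i(k,r) ≤ N holds iff some such graph has at most N vertices.
BetaAtMost : ℕ → ℕ → ℕ → ℕ → Set₁
BetaAtMost i k r N =
  Σ ℕ λ n → n ≤ N × Σ (KPartiteGraph k n) λ G → IsBetaWitness i r G

module Submission where

-- Write m = r-1 and N = i·m + 1.  The witness is the circulant graph on the
-- cycle ℤ/Nℤ in which two vertices are adjacent when they are at cyclic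
-- distance at least i in both directions; every vertex forms a part of its own
-- (the remaining k - N parts are empty).
--   * K_{m+1}-freeness: measuring positions clockwise from one vertex of a
--     clique, all positions lie in [0, m·i), so two of the m+1 vertices fall
--     into the same block [b·i, (b+1)·i) and are too close to be adjacent.
--   * The progressions x, x+i, …, x+(m-1)i (mod N) are cliques K_m.
--   * If S omits exactly i parts, each omitted vertex lies on at most m of the
--     N progressions; since i·m < N, some progression lies entirely inside S.
--     Constructively this is a pigeonhole argument on the map sending a
--     progression to (omitted vertex it meets, step at which it meets it).
-- The file first proves a pigeonhole principle for maps into the complement of
-- a subset, then the arithmetic of ℤ/Nℤ on representatives 0, …, N-1, then the
-- three properties of the circulant graph, and finally the proposition.

open import Defs hiding (sym)
open import Data.Nat
open import Data.Nat.Properties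
open import Data.Nat.DivMod
open import Data.Fin using (Fin; zero; suc; toℕ; fromℕ<; inject≤; combine)
import Data.Fin.Properties as FP
open import Data.Fin.Subset using (Subset; _∈_; _∉_; ∣_∣; ∁; inside; outside)
open import Data.Fin.Subset.Properties using (_∈?_; x∉p⇒x∈∁p; ∣∁p∣≡n∸∣p∣)
open import Data.Vec using (_∷_; here; there)
open import Data.Product using (∃; ∃₂; _×_; _,_; proj₁; proj₂; swap)
open import Data.Sum using (inj₁; inj₂)
open import Relation.Binary.PropositionalEquality
open import Relation.Binary.Definitions using (tri<; tri≈; tri>)
open import Relation.Nullary using (¬_; yes; no)
open import Data.Empty using (⊥-elim)

position : ∀ {k} {x : Fin k} (T : Subset k) → x ∈ T → Fin ∣ T ∣
position (inside ∷ T) here = zero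
position (inside ∷ T) (there x∈T) = suc (position T x∈T)
position (outside ∷ T) (there x∈T) = position T x∈T

position-injective : ∀ {k} {x y : Fin k} (T : Subset k) (x∈T : x ∈ T) (y∈T : y ∈ T) →
  position T x∈T ≡ position T y∈T → x ≡ y
position-injective (inside ∷ T) here here _ = refl
position-injective (inside ∷ T) (there x∈T) (there y∈T) eq =
  cong suc (position-injective T x∈T y∈T (FP.suc-injective eq))
position-injective (outside ∷ T) (there x∈T) (there y∈T) eq =
  cong suc (position-injective T x∈T y∈T eq)

pigeonhole-outside : ∀ {n k m} (S : Subset k) (p : Fin n → Fin k) (q : Fin n → Fin m) →
  (∀ x → p x ∉ S) → ∣ ∁ S ∣ * m < n → ∃₂ λ x y → x ≢ y × p x ≡ p y × q x ≡ q y
pigeonhole-outside {n} {m = m} S p q p∉S few =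
  let x , y , x<y , same = FP.pigeonhole few label
  in x , y , FP.<⇒≢ x<y ,
     position-injective (∁ S) _ _ (FP.combine-injectiveˡ (rank x) (q x) (rank y) (q y) same) ,
     FP.combine-injectiveʳ (rank x) (q x) (rank y) (q y) same
  where
  rank : Fin n → Fin ∣ ∁ S ∣
  rank z = position (∁ S) (x∉p⇒x∈∁p (p∉S z))
  label : Fin n → Fin (∣ ∁ S ∣ * m)
  label z = combine (rank z) (q z)

-- Arithmetic on the cycle ℤ/Nℤ, computed on the representatives 0, …, N-1.
module Cyclic (N : ℕ) .{{_ : NonZero N}} where

  infixl 6 _⊕_

  _⊕_ : ℕ → ℕ → ℕ
  a ⊕ d = (a + d) % N

  -- Clockwise distance from a to b on the N-cycle.
  dist : ℕ → ℕ → ℕ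
  dist a b = b ⊕ (N ∸ a)

  ⊕-< : ∀ a d → a ⊕ d < N
  ⊕-< a d = m%n<n (a + d) N

  ⊕-comm : ∀ a d → a ⊕ d ≡ d ⊕ a
  ⊕-comm a d = cong (_% N) (+-comm a d)

  ⊕-reduceˡ : ∀ a d e → a ⊕ d ⊕ e ≡ (a + d) ⊕ e
  ⊕-reduceˡ a d e = begin
    ((a + d) % N + e) % N              ≡⟨ %-distribˡ-+ ((a + d) % N) e N ⟩
    ((a + d) % N % N + e % N) % N      ≡⟨ cong (λ z → (z + e % N) % N) (m%n%n≡m%n (a + d) N) ⟩
    ((a + d) % N + e % N) % N          ≡⟨ %-distribˡ-+ (a + d) e N ⟨
    (a + d + e) % N                    ∎
    where open ≡-Reasoning

  ⊕-reduceʳ : ∀ a d → a ⊕ (d % N) ≡ a ⊕ d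
  ⊕-reduceʳ a d = begin
    a ⊕ (d % N)      ≡⟨ ⊕-comm a (d % N) ⟩
    d % N ⊕ a        ≡⟨ cong (λ z → z % N ⊕ a) (+-identityʳ d) ⟨
    d ⊕ 0 ⊕ a        ≡⟨ ⊕-reduceˡ d 0 a ⟩
    (d + 0) ⊕ a      ≡⟨ cong (_⊕ a) (+-identityʳ d) ⟩
    d ⊕ a            ≡⟨ ⊕-comm d a ⟩
    a ⊕ d            ∎
    where open ≡-Reasoning

  ⊕-zero : ∀ {a} → a < N → a ⊕ 0 ≡ a
  ⊕-zero {a} a<N = trans (cong (_% N) (+-identityʳ a)) (m<n⇒m%n≡m a<N)

  ⊕-undo : ∀ {c x} → c ≤ N → x < N → x ⊕ c ⊕ (N ∸ c) ≡ x
  ⊕-undo {c} {x} c≤N x<N = begin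
    x ⊕ c ⊕ (N ∸ c)          ≡⟨ ⊕-reduceˡ x c (N ∸ c) ⟩
    (x + c + (N ∸ c)) % N    ≡⟨ cong (_% N) (+-assoc x c (N ∸ c)) ⟩
    (x + (c + (N ∸ c))) % N  ≡⟨ cong (λ z → (x + z) % N) (m+[n∸m]≡n c≤N) ⟩
    (x + N) % N              ≡⟨ [m+n]%n≡m%n x N ⟩
    x % N                    ≡⟨ m<n⇒m%n≡m x<N ⟩
    x                        ∎
    where open ≡-Reasoning

  ⊕-undo′ : ∀ {c x} → c ≤ N → x < N → x ⊕ (N ∸ c) ⊕ c ≡ x
  ⊕-undo′ {c} {x} c≤N x<N =
    subst (λ z → x ⊕ (N ∸ c) ⊕ z ≡ x) (m∸[m∸n]≡n c≤N) (⊕-undo (m∸n≤m N c) x<N)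

  ⊕-cancelʳ : ∀ {x y} c → x < N → y < N → x ⊕ c ≡ y ⊕ c → x ≡ y
  ⊕-cancelʳ {x} {y} c x<N y<N eq = begin
    x                           ≡⟨ ⊕-undo c%N≤N x<N ⟨
    x ⊕ (c % N) ⊕ (N ∸ c % N)   ≡⟨ cong (_⊕ (N ∸ c % N)) reduced ⟩
    y ⊕ (c % N) ⊕ (N ∸ c % N)   ≡⟨ ⊕-undo c%N≤N y<N ⟩
    y                           ∎
    where
    open ≡-Reasoning
    c%N≤N : c % N ≤ N
    c%N≤N = m%n≤n c N
    reduced : x ⊕ (c % N) ≡ y ⊕ (c % N)
    reduced = trans (⊕-reduceʳ x c) (trans eq (sym (⊕-reduceʳ y c)))

  dist-< : ∀ a b → dist a b < N
  dist-< a b = ⊕-< b (N ∸ a)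

  ⊕-dist : ∀ {a b} → a ≤ N → b < N → a ⊕ dist a b ≡ b
  ⊕-dist {a} {b} a≤N b<N = trans (⊕-comm a (dist a b)) (⊕-undo′ a≤N b<N)

  dist-unique : ∀ {a b d} → a ≤ N → d < N → a ⊕ d ≡ b → dist a b ≡ d
  dist-unique {a} {b} {d} a≤N d<N a⊕d≡b = begin
    dist a b        ≡⟨ cong (dist a) a⊕d≡b ⟨
    dist a (a ⊕ d)  ≡⟨ cong (dist a) (⊕-comm a d) ⟩
    d ⊕ a ⊕ (N ∸ a) ≡⟨ ⊕-undo a≤N d<N ⟩
    d               ∎
    where open ≡-Reasoning

  dist-self : ∀ {a} → a < N → dist a a ≡ 0
  dist-self {a} a<N = dist-unique (<⇒≤ a<N) (>-nonZero⁻¹ N) (⊕-zero a<N)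

  dist-flip : ∀ {a b} → a < N → b < N → a ≢ b → dist b a ≡ N ∸ dist a b
  dist-flip {a} {b} a<N b<N a≢b =
    dist-unique (<⇒≤ b<N) (∸-monoʳ-< (n≢0⇒n>0 dist≢0) (<⇒≤ (dist-< a b))) back
    where
    dist≢0 : dist a b ≢ 0
    dist≢0 d≡0 = a≢b (trans (sym (⊕-zero a<N)) (trans (cong (a ⊕_) (sym d≡0)) (⊕-dist (<⇒≤ a<N) b<N)))
    back : b ⊕ (N ∸ dist a b) ≡ a
    back = begin
      b ⊕ (N ∸ dist a b)              ≡⟨ cong (_⊕ (N ∸ dist a b)) (⊕-dist (<⇒≤ a<N) b<N) ⟨
      a ⊕ dist a b ⊕ (N ∸ dist a b)   ≡⟨ ⊕-undo (<⇒≤ (dist-< a b)) a<N ⟩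
      a                               ∎
      where open ≡-Reasoning

  dist-between : ∀ {a b c} → a ≤ N → b < N → c < N → dist a b ≤ dist a c →
    dist b c ≡ dist a c ∸ dist a b
  dist-between {a} {b} {c} a≤N b<N c<N ab≤ac =
    dist-unique (<⇒≤ b<N) (≤-<-trans (m∸n≤m (dist a c) (dist a b)) (dist-< a c)) forward
    where
    forward : b ⊕ (dist a c ∸ dist a b) ≡ c
    forward = begin
      b ⊕ (dist a c ∸ dist a b)                 ≡⟨ cong (_⊕ (dist a c ∸ dist a b)) (⊕-dist a≤N b<N) ⟨
      a ⊕ dist a b ⊕ (dist a c ∸ dist a b)      ≡⟨ ⊕-reduceˡ a (dist a b) _ ⟩
      (a + dist a b + (dist a c ∸ dist a b)) % N ≡⟨ cong (_% N) (+-assoc a (dist a b) _) ⟩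
      a ⊕ (dist a b + (dist a c ∸ dist a b))    ≡⟨ cong (a ⊕_) (m+[n∸m]≡n ab≤ac) ⟩
      a ⊕ dist a c                              ≡⟨ ⊕-dist a≤N c<N ⟩
      c                                         ∎
      where open ≡-Reasoning

-- As a k-partite graph
-- (N ≤ k) vertex v forms part v on its own and the other parts are empty.
module Circulant (N g : ℕ) .{{_ : NonZero N}} .{{_ : NonZero g}} {k : ℕ} (N≤k : N ≤ k) where
  open Cyclic N

  Far : ℕ → ℕ → Set
  Far a b = g ≤ dist a b × g ≤ dist b a

  Far-irrefl : ∀ {a} → a < N → ¬ Far a a
  Far-irrefl a<N (g≤dist , _) = <⇒≱ (>-nonZero⁻¹ g) (subst (g ≤_) (dist-self a<N) g≤dist)

  -- Distinct parts are distinct vertices, so irreflexivity makes each part independent.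
  graph : KPartiteGraph k N
  graph = record
    { Adj     = λ u v → Far (toℕ u) (toℕ v)
    ; sym     = swap
    ; irrefl  = λ {u} → Far-irrefl (FP.toℕ<n u)
    ; part    = λ v → inject≤ v N≤k
    ; partite = λ {u} {v} u~v same-part →
        Far-irrefl (FP.toℕ<n v)
          (subst (λ w → Far (toℕ w) (toℕ v)) (FP.inject≤-injective N≤k N≤k u v same-part) u~v)
    }

  same-block : ∀ {x y} → x ≤ y → x / g ≡ y / g → y ∸ x < g
  same-block {x} {y} x≤y same = begin-strict
    y ∸ x                     ≤⟨ ∸-monoʳ-≤ y (m/n*n≤m x g) ⟩
    y ∸ (x / g) * g           ≡⟨ cong (λ z → y ∸ z * g) same ⟩
    y ∸ (y / g) * g           ≡⟨ cong (_∸ (y / g) * g) (m≡m%n+[m/n]*n y g) ⟩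
    y % g + (y / g) * g ∸ (y / g) * g ≡⟨ m+n∸n≡m (y % g) ((y / g) * g) ⟩
    y % g                     <⟨ m%n<n y g ⟩
    g                         ∎
    where open ≤-Reasoning

  same-block-not-far : ∀ {a b c} → a ≤ N → b < N → c < N →
    dist a b / g ≡ dist a c / g → ¬ Far b c
  same-block-not-far {a} {b} {c} a≤N b<N c<N same (g≤bc , g≤cb)
    with ≤-total (dist a b) (dist a c)
  ... | inj₁ ab≤ac = <⇒≱ (subst (_< g) (sym (dist-between a≤N b<N c<N ab≤ac)) (same-block ab≤ac same)) g≤bc
  ... | inj₂ ac≤ab = <⇒≱ (subst (_< g) (sym (dist-between a≤N c<N b<N ac≤ab)) (same-block ac≤ab (sym same))) g≤cb

  far-dist-bound : ∀ {a b} → a < N → b < N → Far a b → dist a b + g ≤ N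
  far-dist-bound {a} {b} a<N b<N (g≤ab , g≤ba) = begin
    dist a b + g                  ≤⟨ +-monoʳ-≤ (dist a b) (subst (g ≤_) (dist-flip a<N b<N a≢b) g≤ba) ⟩
    dist a b + (N ∸ dist a b)     ≡⟨ m+[n∸m]≡n (<⇒≤ (dist-< a b)) ⟩
    N                             ∎
    where
    open ≤-Reasoning
    a≢b : a ≢ b
    a≢b refl = Far-irrefl a<N (g≤ab , g≤ba)

  -- m + 1 pairwise far points need a cycle of length at least (m + 1)·g:
  -- seen from one of them all lie in the m blocks below m·g, so two share one.
  no-large-clique : ∀ m .{{_ : NonZero m}} → N < suc m * g → KFree graph (suc m)
  no-large-clique m N<[1+m]g (f , clique) =
    let c , c′ , c<c′ , same = FP.pigeonhole (n<1+n m) block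
    in same-block-not-far (<⇒≤ (FP.toℕ<n (f zero))) (FP.toℕ<n (f c)) (FP.toℕ<n (f c′))
         (block-index c c′ same) (clique c c′ (FP.<⇒≢ c<c′))
    where
    offset : Fin (suc m) → ℕ
    offset c = dist (toℕ (f zero)) (toℕ (f c))
    offset-< : ∀ c → offset c < m * g
    offset-< zero = subst (_< m * g) (sym (dist-self (FP.toℕ<n (f zero))))
                      (>-nonZero⁻¹ (m * g) {{m*n≢0 m g}})
    offset-< (suc c) = +-cancelʳ-< g (offset (suc c)) (m * g) (begin-strict
      offset (suc c) + g  ≤⟨ far-dist-bound (FP.toℕ<n (f zero)) (FP.toℕ<n (f (suc c))) (clique zero (suc c) λ ()) ⟩
      N                   <⟨ N<[1+m]g ⟩
      g + m * g           ≡⟨ +-comm g (m * g) ⟩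
      m * g + g           ∎)
      where open ≤-Reasoning
    block : Fin (suc m) → Fin m
    block c = fromℕ< (m<n*o⇒m/o<n (offset-< c))
    block-index : ∀ c c′ → block c ≡ block c′ → offset c / g ≡ offset c′ / g
    block-index c c′ same = trans (sym (FP.toℕ-fromℕ< _)) (trans (cong toℕ same) (FP.toℕ-fromℕ< _))

  progression : ∀ {m} → Fin N → Fin m → Fin N
  progression x j = fromℕ< (⊕-< (toℕ x) (toℕ j * g))

  toℕ-progression : ∀ {m} x (j : Fin m) → toℕ (progression x j) ≡ toℕ x ⊕ toℕ j * g
  toℕ-progression x j = FP.toℕ-fromℕ< _

  progression-injective : ∀ {m} {x y} (j : Fin m) → progression x j ≡ progression y j → x ≡ y
  progression-injective {x = x} {y} j same = FP.toℕ-injective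
    (⊕-cancelʳ (toℕ j * g) (FP.toℕ<n x) (FP.toℕ<n y)
      (trans (sym (toℕ-progression x j)) (trans (cong toℕ same) (toℕ-progression y j))))

  progression-step : ∀ x {a b} → a ≤ b → x ⊕ a * g ⊕ (b ∸ a) * g ≡ x ⊕ b * g
  progression-step x {a} {b} a≤b = begin
    x ⊕ a * g ⊕ (b ∸ a) * g        ≡⟨ ⊕-reduceˡ x (a * g) ((b ∸ a) * g) ⟩
    (x + a * g + (b ∸ a) * g) % N  ≡⟨ cong (_% N) (+-assoc x (a * g) ((b ∸ a) * g)) ⟩
    x ⊕ (a * g + (b ∸ a) * g)      ≡⟨ cong (x ⊕_) (*-distribʳ-+ g a (b ∸ a)) ⟨
    x ⊕ (a + (b ∸ a)) * g          ≡⟨ cong (λ z → x ⊕ z * g) (m+[n∸m]≡n a≤b) ⟩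
    x ⊕ b * g                      ∎
    where open ≡-Reasoning

  -- Terms a < b of a progression of length m with m·g ≤ N are at clockwise
  -- distance (b - a)·g and N - (b - a)·g, both at least g.
  progression-far : ∀ {m} → m * g ≤ N → ∀ x (a b : Fin m) → toℕ a < toℕ b →
    Far (toℕ (progression x a)) (toℕ (progression x b))
  progression-far {m} mg≤N x a b a<b =
    subst (g ≤_) (sym dist-forward) g≤d , subst (g ≤_) (sym dist-backward) (m+n≤o⇒m≤o∸n g room)
    where
    u v d : ℕ
    u = toℕ (progression x a)
    v = toℕ (progression x b)
    d = (toℕ b ∸ toℕ a) * g
    room : g + d ≤ N
    room = ≤-trans (*-monoˡ-≤ g (≤-trans (s≤s (m∸n≤m (toℕ b) (toℕ a))) (FP.toℕ<n b))) mg≤N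
    g≤d : g ≤ d
    g≤d = subst (_≤ d) (+-identityʳ g) (*-monoˡ-≤ g (m<n⇒0<n∸m a<b))
    dist-forward : dist u v ≡ d
    dist-forward = dist-unique (<⇒≤ (FP.toℕ<n (progression x a)))
                     (<-≤-trans (m<n+m d (>-nonZero⁻¹ g)) room) (begin
      u ⊕ d                                  ≡⟨ cong (_⊕ d) (toℕ-progression x a) ⟩
      toℕ x ⊕ toℕ a * g ⊕ d                  ≡⟨ progression-step (toℕ x) (<⇒≤ a<b) ⟩
      toℕ x ⊕ toℕ b * g                      ≡⟨ toℕ-progression x b ⟨
      v                                      ∎)
      where open ≡-Reasoning
    u≢v : u ≢ v
    u≢v u≡v = <⇒≱ (>-nonZero⁻¹ g) (subst (g ≤_) d≡0 g≤d)
      where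
      d≡0 : d ≡ 0
      d≡0 = trans (sym dist-forward)
                  (trans (cong (dist u) (sym u≡v)) (dist-self (FP.toℕ<n (progression x a))))
    dist-backward : dist v u ≡ N ∸ d
    dist-backward = trans (dist-flip (FP.toℕ<n (progression x a)) (FP.toℕ<n (progression x b)) u≢v)
                          (cong (N ∸_) dist-forward)

  progression-clique : ∀ {m} → m * g ≤ N → ∀ x → IsClique graph (progression {m} x)
  progression-clique mg≤N x a b a≢b with <-cmp (toℕ a) (toℕ b)
  ... | tri< a<b _ _ = progression-far mg≤N x a b a<b
  ... | tri≈ _ a≡b _ = ⊥-elim (a≢b (FP.toℕ-injective a≡b))
  ... | tri> _ _ b<a = swap (progression-far mg≤N x b a b<a)

  -- If ∣∁ S∣ · m < N then some progression of length m lies inside the parts S: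
  -- otherwise record, for each x, a step at which progression x leaves S;
  -- by pigeonhole two progressions leave S at the same vertex in the same step,
  -- so they coincide.
  progression-inside : ∀ {m} (S : Subset k) → ∣ ∁ S ∣ * m < N →
    ∃ λ x → ∀ j → part graph (progression {m} x j) ∈ S
  progression-inside {m} S few
    with FP.any? (λ x → FP.all? (λ j → part graph (progression {m} x j) ∈? S))
  ... | yes inside-S = inside-S
  ... | no none =
    let x , y , x≢y , same-part , same-step = pigeonhole-outside S exit step exit∉S few
    in ⊥-elim (x≢y (progression-injective (step x)
         (trans (FP.inject≤-injective N≤k N≤k _ _ same-part) (cong (progression y) (sym same-step)))))
    where
    leaves : ∀ x → ∃ λ j → part graph (progression {m} x j) ∉ S
    leaves x = FP.¬∀⟶∃¬ m _ (λ j → part graph (progression x j) ∈? S) (λ all-in → none (x , all-in))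
    step : Fin N → Fin m
    step x = proj₁ (leaves x)
    exit : Fin N → Fin k
    exit x = part graph (progression x (step x))
    exit∉S : ∀ x → exit x ∉ S
    exit∉S x = proj₂ (leaves x)

proposition3p5 : ∀ (i k r : ℕ) → 2 ≤ r → 2 ≤ i → i * (r ∸ 1) + 1 ≤ k →
    BetaAtMost i k r (i * (r ∸ 1) + 1)
proposition3p5 i@(suc (suc _)) k (suc m@(suc _)) (s≤s (s≤s z≤n)) 2≤i@(s≤s (s≤s z≤n)) N≤k =
  N , ≤-refl , graph , no-large-clique m N<[1+m]i , covered
  where
  N : ℕ
  N = i * m + 1
  open Circulant N i N≤k
  open ≤-Reasoning
  N<[1+m]i : N < suc m * i
  N<[1+m]i = begin-strict
    i * m + 1  <⟨ +-monoʳ-< (i * m) 2≤i ⟩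
    i * m + i  ≡⟨ cong₂ _+_ (*-comm i m) refl ⟩
    m * i + i  ≡⟨ +-comm (m * i) i ⟩
    suc m * i  ∎
  mi≤N : m * i ≤ N
  mi≤N = ≤-trans (≤-reflexive (*-comm m i)) (m≤m+n (i * m) 1)
  omitted : ∀ S → ∣ S ∣ ≡ k ∸ i → ∣ ∁ S ∣ ≡ i
  omitted S |S|≡k∸i = begin-equality
    ∣ ∁ S ∣        ≡⟨ ∣∁p∣≡n∸∣p∣ S ⟩
    k ∸ ∣ S ∣      ≡⟨ cong (k ∸_) |S|≡k∸i ⟩
    k ∸ (k ∸ i)    ≡⟨ m∸[m∸n]≡n (≤-trans (≤-trans (m≤m*n i m) (m≤m+n (i * m) 1)) N≤k) ⟩
    i              ∎
  covered : ∀ S → ∣ S ∣ ≡ k ∸ i → ContainsCliqueIn graph S m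
  covered S |S|≡k∸i =
    let x , x-inside = progression-inside S
                         (subst (λ o → o * m < N) (sym (omitted S |S|≡k∸i)) (m<m+n (i * m) z<s))
    in progression x , progression-clique mi≤N x , x-inside
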